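{- Let $a>1$, $m$, $s$, $k$ be positive integers, let $r=2ams-1$, and set \[ D:=m\left(2r^k+m\left(s-ar^k\right)^2\right). \] Define $q_1,\dots,q_{3k}$ by $q_{3j+1}=ar^j-1$, $q_{3j+2}=1$, $q_{3j+3}=2amr^{k-1-j}-1$ for $0\le j\le k-1$ (so the sequence is $a-1,1,2amr^{k-1}-1,\ ar-1,1,2amr^{k-2}-1,\dots,ar^{k-1}-1,1,2am-1$). Then $l(D)=6k+2$ and \[ \sqrt D=[m(ar^k-s);\overline{q_1,\dots,q_{3k},\,ar^k-s,\,q_{3k},\dots,q_1,\,2m(ar^k-s)}]. \]
   Context: For a positive non-square integer $D$, $l(D)$ denotes the length of the fundamental (shortest) period of the regular continued fraction expansion of $\sqrt D$. $[a_0;\overline{b_1,\dots,b_m}]$ denotes the regular continued fraction whose partial quotients after $a_0$ are the block $b_1,\dots,b_m$ repeated infinitely often. -}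

module Defs where

open import Data.Nat as ℕ using (ℕ; zero; suc; _≤ᵇ_)
open import Data.Integer as ℤ using (ℤ; +_; +[1+_]; -[1+_])
open import Data.Integer.DivMod using (_/_)
open import Data.Bool using (if_then_else_)
open import Data.List using (List; []; _∷_; _++_; reverse; concatMap; upTo)
open import Data.Product using (_×_; _,_; proj₁; proj₂)
open import Relation.Binary.PropositionalEquality using (_≡_)
open import Relation.Nullary using (¬_)

isqrtGo : ℕ → ℕ → ℕ
isqrtGo D zero = zero
isqrtGo D (suc n) = if (suc n ℕ.* suc n) ≤ᵇ D then suc n else isqrtGo D n

isqrt : ℕ → ℕ
isqrt D = isqrtGo D D

-- integer division that returns 0 for divisor 0 (never used with 0 in the
-- expansion of √D, where all denominators Q are positive)
safeDiv : ℤ → ℤ → ℤ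
safeDiv n (+ zero) = + zero
safeDiv n d@(+[1+ k ]) = n / d
safeDiv n d@(-[1+ k ]) = n / d

-- A complete quotient (P + √D) / Q is represented by the pair (P , Q).
-- floor((P + √D)/Q) = floor((P + ⌊√D⌋)/Q) for Q > 0 (floor division).
cfFloor : ℕ → ℤ × ℤ → ℤ
cfFloor D (P , Q) = safeDiv (P ℤ.+ + isqrt D) Q

-- x ↦ 1 / (x - ⌊x⌋) on (P + √D)/Q :
-- gives (P' + √D)/Q' with P' = aQ - P, Q' = (D - P'^2)/Q.
cfStep : ℕ → ℤ × ℤ → ℤ × ℤ
cfStep D (P , Q) =
  let a  = cfFloor D (P , Q)
      P' = a ℤ.* Q ℤ.- P
  in P' , safeDiv (+ D ℤ.- P' ℤ.* P') Q

cfState : ℕ → ℕ → ℤ × ℤ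
cfState D zero = (+ 0 , + 1)
cfState D (suc n) = cfStep D (cfState D n)

cfSqrt : ℕ → ℕ → ℤ
cfSqrt D n = cfFloor D (cfState D n)

IsPeriod : ℕ → ℕ → Set
IsPeriod D p = ∀ n → cfSqrt D (suc n ℕ.+ p) ≡ cfSqrt D (suc n)

PeriodLength : ℕ → ℕ → Set
PeriodLength D p = (0 ℕ.< p) × IsPeriod D p × (∀ p' → 0 ℕ.< p' → p' ℕ.< p → ¬ IsPeriod D p')

nth : List ℕ → ℕ → ℕ
nth [] i = 0
nth (x ∷ xs) zero = x
nth (x ∷ xs) (suc i) = nth xs i

qSeq : ℕ → ℕ → ℕ → ℕ → List ℕ
qSeq a m r k = concatMap
  (λ j → (a ℕ.* r ℕ.^ j ℕ.∸ 1) ∷ 1 ∷ (2 ℕ.* a ℕ.* m ℕ.* r ℕ.^ (k ℕ.∸ 1 ℕ.∸ j) ℕ.∸ 1) ∷ [])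
  (upTo k)

block : ℕ → ℕ → ℕ → ℕ → ℕ → List ℕ
block a m s r k =
  let c = a ℕ.* r ℕ.^ k ℕ.∸ s in
  qSeq a m r k ++ (c ∷ []) ++ reverse (qSeq a m r k) ++ (2 ℕ.* m ℕ.* c ∷ [])

{-# OPTIONS --safe #-}
module Submission where

-- Write K = r^k, c = aK - s and x = mc.  Then D = x² + 2mK with 2mK ≤ 2x, so ⌊√D⌋ = x.
-- Writing (P, Q) for the complete quotient (P + √D)/Q, the first step leads from (0, 1) to
-- (x, 2mK).  For every splitting K = R r T with R = r^j and T = r^t, the partial quotients
-- aR - 1, 1, 2amT - 1 lead from (x, 2m r T) to (x, 2m T); once r = 2ams - 1 is substituted
-- this is a polynomial identity check.  After k such triples the state is (x, 2m), the
-- partial quotient c leads to (x, K), and the same triples read backwards (the recurrences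
-- P′ + P = qQ, D = P′² + QQ′ are symmetric in the two states) lead down to (x, 1), from which
-- 2x = 2mc returns to (x, 2mK).  The period is therefore the palindromic block of length
-- 6k + 2, and no shorter period exists because its last entry 2mc exceeds every other
-- partial quotient.

open import Defs
open import Data.Bool using (T; true; false)
open import Data.Empty using (⊥-elim)
open import Data.Integer as ℤ using (ℤ; +_; +[1+_]; 0ℤ; +≤+; +<+)
import Data.Integer.Properties as ℤP
open import Data.Integer.DivMod using ([n/d]*d≤n; n<s[n/ℕd]*d; div-pos-is-/ℕ)
open import Data.List using (List; []; _∷_; _++_; length; reverse; concatMap; upTo)
import Data.List.Properties as LP
open import Data.List.Relation.Unary.All as All using (All; []; _∷_)
import Data.List.Relation.Unary.All.Properties as All
import Data.List.Relation.Unary.Any.Properties as Any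
open import Data.Nat as ℕ using (zero; suc; z≤n; s≤s; _≤ᵇ_)
import Data.Nat.DivMod as ℕD
import Data.Nat.Properties as ℕP
import Data.Nat.Tactic.RingSolver as ℕ-Solver
open import Data.Product using (_×_; _,_; proj₁; proj₂)
open import Data.Sum using (inj₁; inj₂)
open import Function using (id)
open import Relation.Binary.PropositionalEquality
open import Relation.Nullary using (¬_)

module CompleteQuotients where

  open import Data.Integer using (_+_; _-_; _*_; _≤_; _<_)
  open import Data.Integer.Tactic.RingSolver using (solve-∀)

  square-cancel-< : ∀ {m n} → m ℕ.* m ℕ.< n ℕ.* n → m ℕ.< n
  square-cancel-< lt = ℕP.≰⇒> (λ n≤m → ℕP.<⇒≱ lt (ℕP.*-mono-≤ n≤m n≤m))

  isqrtGo-unique : ∀ {D x} n → x ℕ.≤ n → x ℕ.* x ℕ.≤ D → D ℕ.< suc x ℕ.* suc x → isqrtGo D n ≡ x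
  isqrtGo-unique zero z≤n _ _ = refl
  isqrtGo-unique {D} {x} (suc n) x≤1+n lo hi with suc n ℕ.* suc n ≤ᵇ D in eq | ℕP.m≤n⇒m<n∨m≡n x≤1+n
  ... | true  | _              =
    ℕP.≤-antisym (ℕ.s≤s⁻¹ (square-cancel-< (ℕP.≤-<-trans (ℕP.≤ᵇ⇒≤ _ _ (subst T (sym eq) _)) hi)))
                 x≤1+n
  ... | false | inj₁ (s≤s x≤n) = isqrtGo-unique n x≤n lo hi
  ... | false | inj₂ refl      = ⊥-elim (subst T eq (ℕP.≤⇒≤ᵇ lo))

  isqrt-unique : ∀ {D x} → x ℕ.* x ℕ.≤ D → D ℕ.< suc x ℕ.* suc x → isqrt D ≡ x
  isqrt-unique {D} {zero}  lo hi = isqrtGo-unique D z≤n lo hi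
  isqrt-unique {D} {suc x} lo hi = isqrtGo-unique D (ℕP.≤-trans (ℕP.m≤m*n (suc x) (suc x)) lo) lo hi

  i<suc[j]⇒i≤j : ∀ {i j} → i < ℤ.suc j → i ≤ j
  i<suc[j]⇒i≤j {i} {j} i<1+j = subst (i ≤_) (ℤP.pred-suc j) (ℤP.i<j⇒i≤pred[j] i<1+j)

  safeDiv-unique : ∀ {n d q} → 0ℤ < d → q * d ≤ n → n < q * d + d → safeDiv n d ≡ q
  safeDiv-unique {d = + zero} (+<+ ())
  safeDiv-unique {n} {d@(+[1+ δ ])} {q} _ lo hi = ℤP.≤-antisym (i<suc[j]⇒i≤j n/d<1+q) (i<suc[j]⇒i≤j q<1+n/d)
    where
    n/d<1+q : n ℤ./ d < ℤ.suc q
    n/d<1+q = ℤP.*-cancelʳ-<-nonNeg d (ℤP.≤-<-trans ([n/d]*d≤n n d)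
      (subst (n <_) (trans (ℤP.+-comm (q * d) d) (sym (ℤP.suc-* q d))) hi))
    q<1+n/d : q < ℤ.suc (n ℤ./ d)
    q<1+n/d = ℤP.*-cancelʳ-<-nonNeg d (ℤP.≤-<-trans lo
      (subst (λ z → n < ℤ.suc z * d) (sym (div-pos-is-/ℕ n (suc δ))) (n<s[n/ℕd]*d n (suc δ))))

  i<i+j : ∀ i {j} → 0ℤ < j → i < i + j
  i<i+j i 0<j = subst (_< i + _) (ℤP.+-identityʳ i) (ℤP.+-monoʳ-< i 0<j)

  0<j-i⇒i<j : ∀ {i j} → 0ℤ < j - i → i < j
  0<j-i⇒i<j {i} {j} 0<j-i = subst (i <_) (lemma i j) (i<i+j i 0<j-i)
    where
    lemma : ∀ i j → i + (j - i) ≡ j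
    lemma = solve-∀

  data Recurrence (Δ : ℤ) : ℤ × ℤ → ℤ → ℤ × ℤ → Set where
    recurrence : ∀ {P Q q P′ Q′} → P′ + P ≡ q * Q → Δ ≡ P′ * P′ + Q * Q′ →
                 Recurrence Δ (P , Q) q (P′ , Q′)

  Recurrence-invariant : ∀ {Δ P Q q P′ Q′} → Recurrence Δ (P , Q) q (P′ , Q′) → Δ ≡ P′ * P′ + Q * Q′
  Recurrence-invariant (recurrence _ inv) = inv

  data Reduced (X : ℤ) : ℤ × ℤ → Set where
    reduced : ∀ {P Q} → P ≤ X → X < P + Q → Reduced X (P , Q)

  -- P + ⌊√D⌋ = qQ + (⌊√D⌋ - P′), so q is the floor exactly when 0 ≤ ⌊√D⌋ - P′ < Q.
  cfStep-recurrence : ∀ {D X Δ P Q q P′ Q′} → + isqrt D ≡ X → + D ≡ Δ →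
    Recurrence Δ (P , Q) q (P′ , Q′) → Reduced X (P′ , Q) →
    cfFloor D (P , Q) ≡ q × cfStep D (P , Q) ≡ (P′ , Q′)
  cfStep-recurrence {D} {X} {Δ} {P} {Q} {q} {P′} {Q′} hX hD (recurrence sum inv) (reduced P′≤X X<P′+Q) =
    floor , cong₂ _,_ P-eq (trans (cong (λ p → safeDiv (+ D - p * p) Q) P-eq) Q-eq)
    where
    0<Q : 0ℤ < Q
    0<Q = ℤP.≤-<-trans (ℤP.i≤j⇒0≤j-i P′≤X)
                       (subst (X - P′ <_) (lemma P′ Q) (ℤP.+-monoˡ-< (ℤ.- P′) X<P′+Q))
      where
      lemma : ∀ P′ Q → P′ + Q - P′ ≡ Q
      lemma = solve-∀
    floor : cfFloor D (P , Q) ≡ q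
    floor rewrite hX = safeDiv-unique 0<Q
      (subst (_≤ P + X) sum (subst (P′ + P ≤_) (ℤP.+-comm X P) (ℤP.+-monoˡ-≤ P P′≤X)))
      (subst (P + X <_) (trans (lemma P P′ Q) (cong (_+ Q) sum)) (ℤP.+-monoʳ-< P X<P′+Q))
      where
      lemma : ∀ P P′ Q → P + (P′ + Q) ≡ P′ + P + Q
      lemma = solve-∀
    P-eq : cfFloor D (P , Q) * Q - P ≡ P′
    P-eq = trans (cong (λ a → a * Q - P) floor) (trans (cong (_- P) (sym sum)) (lemma P′ P))
      where
      lemma : ∀ P′ P → P′ + P - P ≡ P′
      lemma = solve-∀
    Q-eq : safeDiv (+ D - P′ * P′) Q ≡ Q′
    Q-eq = trans (cong (λ d → safeDiv (d - P′ * P′) Q) (trans hD inv))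
      (trans (cong (λ d → safeDiv d Q) (lemma (P′ * P′) Q Q′))
        (safeDiv-unique 0<Q (ℤP.≤-reflexive (ℤP.*-comm Q′ Q))
          (subst (Q * Q′ <_) (cong (_+ Q) (ℤP.*-comm Q Q′)) (i<i+j (Q * Q′) 0<Q))))
      where
      lemma : ∀ a b c → a + b * c - a ≡ b * c
      lemma = solve-∀

  Recurrence-next : ∀ {Δ P Q q P′ Q′} Q₋ → Δ ≡ P * P + Q₋ * Q →
    P′ + P ≡ q * Q → Q′ ≡ Q₋ + q * (P - P′) → Recurrence Δ (P , Q) q (P′ , Q′)
  Recurrence-next {Δ} {P} {Q} {q} {P′} {Q′} Q₋ inv sum rec = recurrence sum (begin
    Δ                                        ≡⟨ inv ⟩
    P * P + Q₋ * Q                           ≡⟨ expand P P′ Q Q₋ ⟩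
    P′ * P′ + Q * Q₋ + (P′ + P) * (P - P′)   ≡⟨ cong (λ z → P′ * P′ + Q * Q₋ + z * (P - P′)) sum ⟩
    P′ * P′ + Q * Q₋ + q * Q * (P - P′)      ≡⟨ collect P P′ Q Q₋ q ⟩
    P′ * P′ + Q * (Q₋ + q * (P - P′))        ≡⟨ cong (λ z → P′ * P′ + Q * z) (sym rec) ⟩
    P′ * P′ + Q * Q′                         ∎)
    where
    open ≡-Reasoning
    expand : ∀ P P′ Q Q₋ → P * P + Q₋ * Q ≡ P′ * P′ + Q * Q₋ + (P′ + P) * (P - P′)
    expand = solve-∀
    collect : ∀ P P′ Q Q₋ q →
      P′ * P′ + Q * Q₋ + q * Q * (P - P′) ≡ P′ * P′ + Q * (Q₋ + q * (P - P′))
    collect = solve-∀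

  Recurrence-reverse : ∀ {Δ P Q q P′ Q′} Q₋ → Δ ≡ P * P + Q₋ * Q →
    Recurrence Δ (P , Q) q (P′ , Q′) → Recurrence Δ (P′ , Q) q (P , Q₋)
  Recurrence-reverse {P = P} {Q} {P′ = P′} Q₋ inv (recurrence sum _) =
    recurrence (trans (ℤP.+-comm P P′) sum) (trans inv (cong (λ z → P * P + z) (ℤP.*-comm Q₋ Q)))

  reduced-root : ∀ {X Q} → 0ℤ < Q → Reduced X (X , Q)
  reduced-root {X} 0<Q = reduced ℤP.≤-refl (i<i+j X 0<Q)

  reduced-gap : ∀ {X e Q} → 0ℤ ≤ e → 0ℤ < Q - e → Reduced X (X - e , Q)
  reduced-gap {X} {e} {Q} 0≤e 0<Q-e =
    reduced (ℤP.i-j≤i X e {{ℤ.nonNegative 0≤e}}) (0<j-i⇒i<j (subst (0ℤ <_) (sym (lemma X e Q)) 0<Q-e))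
    where
    lemma : ∀ X e Q → X - e + Q - X ≡ Q - e
    lemma = solve-∀

  cfStep-to-root : ∀ {D x P Q q Q′} → isqrt D ≡ x → 0 ℕ.< Q → q ℕ.* Q ≡ x ℕ.+ P →
    D ≡ x ℕ.* x ℕ.+ Q ℕ.* Q′ → cfFloor D (+ P , + Q) ≡ + q × cfStep D (+ P , + Q) ≡ (+ x , + Q′)
  cfStep-to-root {D} {x} {P} {Q} {q} {Q′} hx 0<Q sum inv = cfStep-recurrence (cong +_ hx) refl
    (recurrence (trans (sym (ℤP.pos-+ x P)) (trans (cong +_ (sym sum)) (ℤP.pos-* q Q)))
      (trans (cong +_ inv) (trans (ℤP.pos-+ (x ℕ.* x) (Q ℕ.* Q′))
                                  (cong₂ _+_ (ℤP.pos-* x x) (ℤP.pos-* Q Q′)))))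
    (reduced-root (+<+ 0<Q))

  data Run (D : ℕ.ℕ) : List ℕ.ℕ → ℤ × ℤ → ℤ × ℤ → Set where
    done : ∀ {σ} → Run D [] σ σ
    next : ∀ {σ q qs σ′} → cfFloor D σ ≡ + q → Run D qs (cfStep D σ) σ′ → Run D (q ∷ qs) σ σ′

  Run-≡ : ∀ {D L L′ σ σ′} → L ≡ L′ → Run D L σ σ′ → Run D L′ σ σ′
  Run-≡ refl run = run

  Run-step : ∀ {D σ q σ′ qs σ″} → cfFloor D σ ≡ + q → cfStep D σ ≡ σ′ → Run D qs σ′ σ″ →
    Run D (q ∷ qs) σ σ″
  Run-step {D} {qs = qs} {σ″} floor step run = next floor (subst (λ σ → Run D qs σ σ″) (sym step) run)

  Run-one : ∀ {D σ q σ′} → cfFloor D σ ≡ + q × cfStep D σ ≡ σ′ → Run D (q ∷ []) σ σ′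
  Run-one (floor , step) = Run-step floor step done

  Run-++ : ∀ {D xs ys σ σ′ σ″} → Run D xs σ σ′ → Run D ys σ′ σ″ → Run D (xs ++ ys) σ σ″
  Run-++ done            run = run
  Run-++ (next floor r₁) r₂  = next floor (Run-++ r₁ r₂)

  Run-recurrence : ∀ {D X Δ P Q q P′ Q′ q′ qs σ″} → + isqrt D ≡ X → + D ≡ Δ →
    Recurrence Δ (P , Q) q (P′ , Q′) → Reduced X (P′ , Q) → + q′ ≡ q → Run D qs (P′ , Q′) σ″ →
    Run D (q′ ∷ qs) (P , Q) σ″
  Run-recurrence hX hD rec red hq run with cfStep-recurrence hX hD rec red
  ... | floor , step = Run-step (trans floor (sym hq)) step run

  Run-state : ∀ {D L n σ} → Run D L (cfState D n) σ → cfState D (n ℕ.+ length L) ≡ σ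
  Run-state {D} {n = n} done             = cong (cfState D) (ℕP.+-identityʳ n)
  Run-state {D} {q ∷ L} {n} (next _ run) =
    trans (cong (cfState D) (ℕP.+-suc n (length L))) (Run-state {n = suc n} run)

  Run-nth : ∀ {D L n σ} → Run D L (cfState D n) σ → ∀ i → i ℕ.< length L → cfSqrt D (n ℕ.+ i) ≡ + nth L i
  Run-nth {D} {n = n} (next floor _) zero    _         = trans (cong (cfSqrt D) (ℕP.+-identityʳ n)) floor
  Run-nth {D} {n = n} (next _ run)   (suc i) (s≤s i<l) =
    trans (cong (cfSqrt D) (ℕP.+-suc n i)) (Run-nth {n = suc n} run i i<l)

  periodic-from-return : ∀ {D p} → cfState D (suc p) ≡ cfState D 1 → IsPeriod D p
  periodic-from-return {D} {p} ret n = cong (cfFloor D) (states n)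
    where
    states : ∀ n → cfState D (suc n ℕ.+ p) ≡ cfState D (suc n)
    states zero    = ret
    states (suc n) = cong (cfStep D) (states n)

  IsPeriod-multiple : ∀ {D p} → IsPeriod D p → ∀ q i → cfSqrt D (suc i ℕ.+ q ℕ.* p) ≡ cfSqrt D (suc i)
  IsPeriod-multiple {D} {p} per zero    i = cong (cfSqrt D) (cong suc (ℕP.+-identityʳ i))
  IsPeriod-multiple {D} {p} per (suc q) i =
    trans (cong (cfSqrt D) (reassoc i q p)) (trans (per (i ℕ.+ q ℕ.* p)) (IsPeriod-multiple per q i))
    where
    reassoc : ∀ i q p → suc i ℕ.+ suc q ℕ.* p ≡ suc (i ℕ.+ q ℕ.* p) ℕ.+ p
    reassoc = ℕ-Solver.solve-∀

  IsPeriod-mod : ∀ {D} p .{{_ : ℕ.NonZero p}} → IsPeriod D p →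
    ∀ n → cfSqrt D (suc n) ≡ cfSqrt D (suc (n ℕ.% p))
  IsPeriod-mod {D} p per n =
    trans (cong (λ i → cfSqrt D (suc i)) (ℕD.m≡m%n+[m/n]*n n p)) (IsPeriod-multiple per (n ℕ./ p) (n ℕ.% p))

  no-shorter-period : ∀ {D p} → (∀ i → 0 ℕ.< i → i ℕ.< p → cfSqrt D i < cfSqrt D p) →
    ∀ p′ → 0 ℕ.< p′ → p′ ℕ.< p → ¬ IsPeriod D p′
  no-shorter-period {D} {p} below p′ 0<p′ p′<p per =
    ℤP.<-irrefl (trans (sym (per i)) (cong (cfSqrt D) shift))
      (below (suc i) (s≤s z≤n) (subst (suc i ℕ.<_) shift (ℕP.m<m+n (suc i) 0<p′)))
    where
    i = p ℕ.∸ suc p′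
    shift : suc i ℕ.+ p′ ≡ p
    shift = trans (sym (ℕP.+-suc i p′)) (ℕP.m∸n+n≡m p′<p)

open CompleteQuotients

nth-++-All : ∀ {P : ℕ.ℕ → Set} {xs} ys → All P xs → ∀ {i} → i ℕ.< length xs → P (nth (xs ++ ys) i)
nth-++-All ys (px ∷ _)   {zero}  _         = px
nth-++-All ys (_  ∷ pxs) {suc i} (s≤s i<l) = nth-++-All ys pxs i<l

nth-++-length : ∀ xs {y ys} → nth (xs ++ y ∷ ys) (length xs) ≡ y
nth-++-length []       = refl
nth-++-length (x ∷ xs) = nth-++-length xs

All-reverse : ∀ {P : ℕ.ℕ → Set} {xs} → All P xs → All P (reverse xs)
All-reverse ps = All.tabulate (λ x∈ → All.lookup ps (Any.reverse⁻ x∈))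

-- In the application R = r^j and T = r^t with j + 1 + t = k, so that R r T = r^k.
module TripleRecurrence (A M S R T : ℤ) where

  open import Data.Integer using (_+_; _-_; _*_; _≤_; _<_)
  open import Data.Integer.Tactic.RingSolver using (solve-∀)

  r X q₁ q₃ e w Q₀ P₁ Q₁ P₂ Q₂ Q₃ Δ : ℤ
  r  = + 2 * A * M * S - + 1
  X  = M * (A * (R * (r * T)) - S)
  q₁ = A * R - + 1
  q₃ = + 2 * A * M * T - + 1
  e  = + 2 * M * (r * T - S)
  w  = r * R - + 2 * M * S
  Q₀ = + 2 * M * (r * T)
  P₁ = X - e
  Q₁ = R + q₁ * e
  P₂ = X - w
  Q₂ = r * R
  Q₃ = + 2 * M * T
  Δ  = X * X + R * Q₀

  -- The ring solver does not unfold definitions, so these identities are stated for arbitrary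
  -- integers, with the definitions of r, X, e and w written out.
  private
    step₁-sum : ∀ A M S R T r → let X = M * (A * (R * (r * T)) - S) in
      X - + 2 * M * (r * T - S) + X ≡ (A * R - + 1) * (+ 2 * M * (r * T))
    step₁-sum = solve-∀

    step₁-Q : ∀ R q e X → R + q * e ≡ R + q * (X - (X - e))
    step₁-Q = solve-∀

    step₂-sum : ∀ A M S R T →
      let r = + 2 * A * M * S - + 1 ; X = M * (A * (R * (r * T)) - S)
          e = + 2 * M * (r * T - S) ; w = r * R - + 2 * M * S
      in X - w + (X - e) ≡ + 1 * (R + (A * R - + 1) * e)
    step₂-sum = solve-∀

    step₂-Q : ∀ M S R T r X →
      r * R ≡ + 2 * M * (r * T) + + 1 * (X - + 2 * M * (r * T - S) - (X - (r * R - + 2 * M * S)))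
    step₂-Q = solve-∀

    step₃-sum : ∀ A M S R T r → let X = M * (A * (R * (r * T)) - S) in
      X + (X - (r * R - + 2 * M * S)) ≡ (+ 2 * A * M * T - + 1) * (r * R)
    step₃-sum = solve-∀

    step₃-Q : ∀ A M S R T →
      let r = + 2 * A * M * S - + 1 ; X = M * (A * (R * (r * T)) - S)
          e = + 2 * M * (r * T - S) ; w = r * R - + 2 * M * S
      in + 2 * M * T ≡ R + (A * R - + 1) * e + (+ 2 * A * M * T - + 1) * (X - w - X)
    step₃-Q = solve-∀

    Q₁-w : ∀ A M S R T → let r = + 2 * A * M * S - + 1 in
      R + (A * R - + 1) * (+ 2 * M * (r * T - S)) - (r * R - + 2 * M * S)
        ≡ + 2 * R + + 2 * M * (A * R - + 2 + + 1) * (r * T - + 2 * S)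
    Q₁-w = solve-∀

  step₁ : Recurrence Δ (X , Q₀) q₁ (P₁ , Q₁)
  step₁ = Recurrence-next R refl (step₁-sum A M S R T r) (step₁-Q R q₁ e X)

  step₂ : Recurrence Δ (P₁ , Q₁) (+ 1) (P₂ , Q₂)
  step₂ = Recurrence-next Q₀ (Recurrence-invariant step₁) (step₂-sum A M S R T) (step₂-Q M S R T r X)

  step₃ : Recurrence Δ (P₂ , Q₂) q₃ (X , Q₃)
  step₃ = Recurrence-next Q₁ (Recurrence-invariant step₂) (step₃-sum A M S R T r) (step₃-Q A M S R T)

  step₃ʳ : Recurrence Δ (X , Q₂) q₃ (P₂ , Q₁)
  step₃ʳ = Recurrence-reverse Q₁ (Recurrence-invariant step₂) step₃

  step₂ʳ : Recurrence Δ (P₂ , Q₁) (+ 1) (P₁ , Q₀)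
  step₂ʳ = Recurrence-reverse Q₀ (Recurrence-invariant step₁) step₂

  step₁ʳ : Recurrence Δ (P₁ , Q₀) q₁ (X , R)
  step₁ʳ = Recurrence-reverse R refl step₁

  module Bounds (0<M : 0ℤ < M) (0<S : 0ℤ < S) (0<R : 0ℤ < R) (2≤AR : + 2 ≤ A * R)
                (2S≤rT : + 2 * S ≤ r * T) (2MS≤rR : + 2 * M * S ≤ r * R) where

    private
      0≤+ : ∀ {i j} → 0ℤ ≤ i → 0ℤ ≤ j → 0ℤ ≤ i + j
      0≤+ = ℤP.+-mono-≤

      0≤* : ∀ {i j} → 0ℤ ≤ i → 0ℤ ≤ j → 0ℤ ≤ i * j
      0≤* {i} 0≤i 0≤j =
        subst (_≤ i * _) (ℤP.*-zeroʳ i) (ℤP.*-monoˡ-≤-nonNeg i {{ℤ.nonNegative 0≤i}} 0≤j)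

      0<* : ∀ {i j} → 0ℤ < i → 0ℤ < j → 0ℤ < i * j
      0<* {i} 0<i 0<j = subst (_< i * _) (ℤP.*-zeroʳ i) (ℤP.*-monoˡ-<-pos i {{ℤ.positive 0<i}} 0<j)

      0<2 : 0ℤ < + 2
      0<2 = +<+ (s≤s z≤n)

      0<2M : 0ℤ < + 2 * M
      0<2M = 0<* 0<2 0<M

      0<2MS : 0ℤ < + 2 * M * S
      0<2MS = 0<* 0<2M 0<S

      0≤rT-2S : 0ℤ ≤ r * T - + 2 * S
      0≤rT-2S = ℤP.i≤j⇒0≤j-i 2S≤rT

      0≤AR-2 : 0ℤ ≤ A * R - + 2
      0≤AR-2 = ℤP.i≤j⇒0≤j-i 2≤AR

      0≤w : 0ℤ ≤ w
      0≤w = ℤP.i≤j⇒0≤j-i 2MS≤rR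

      0≤e : 0ℤ ≤ e
      0≤e = subst (0ℤ ≤_) (sym (lemma M S (r * T))) (0≤* (ℤP.<⇒≤ 0<2M) (0≤+ 0≤rT-2S (ℤP.<⇒≤ 0<S)))
        where
        lemma : ∀ M S y → + 2 * M * (y - S) ≡ + 2 * M * (y - + 2 * S + S)
        lemma = solve-∀

    reduced₁ : Reduced X (P₁ , Q₀)
    reduced₁ = reduced-gap 0≤e (subst (0ℤ <_) (sym (lemma M S (r * T))) 0<2MS)
      where
      lemma : ∀ M S y → + 2 * M * y - + 2 * M * (y - S) ≡ + 2 * M * S
      lemma = solve-∀

    reduced₂ : Reduced X (P₂ , Q₁)
    reduced₂ = reduced-gap 0≤w (subst (0ℤ <_) (sym (Q₁-w A M S R T))
      (ℤP.+-mono-<-≤ (0<* 0<2 0<R) (0≤* (0≤* (ℤP.<⇒≤ 0<2M) (0≤+ 0≤AR-2 (+≤+ z≤n))) 0≤rT-2S)))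

    reduced₃ : Reduced X (X , Q₂)
    reduced₃ = reduced-root (subst (0ℤ <_) (sym (lemma (r * R) (+ 2 * M * S))) (ℤP.+-mono-≤-< 0≤w 0<2MS))
      where
      lemma : ∀ y z → y ≡ y - z + z
      lemma = solve-∀

    reduced₃ʳ : Reduced X (P₂ , Q₂)
    reduced₃ʳ = reduced-gap 0≤w (subst (0ℤ <_) (sym (lemma (r * R) (+ 2 * M * S))) 0<2MS)
      where
      lemma : ∀ y z → y - (y - z) ≡ z
      lemma = solve-∀

    reduced₂ʳ : Reduced X (P₁ , Q₁)
    reduced₂ʳ = reduced-gap 0≤e
      (subst (0ℤ <_) (sym (lemma R (A * R) e)) (ℤP.+-mono-<-≤ 0<R (0≤* 0≤AR-2 0≤e)))
      where
      lemma : ∀ R y e → R + (y - + 1) * e - e ≡ R + (y - + 2) * e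
      lemma = solve-∀

    reduced₁ʳ : Reduced X (X , Q₀)
    reduced₁ʳ = reduced-root
      (subst (0ℤ <_) (sym (lemma M S (r * T))) (0<* 0<2M (ℤP.+-mono-≤-< 0≤rT-2S (0<* 0<2 0<S))))
      where
      lemma : ∀ M S y → + 2 * M * y ≡ + 2 * M * (y - + 2 * S + + 2 * S)
      lemma = solve-∀

open import Data.Nat using (ℕ; _+_; _*_; _∸_; _^_; _≤_; _<_; _%_)

pos-∸ : ∀ {m n} → n ≤ m → + (m ∸ n) ≡ + m ℤ.- + n
pos-∸ {m} {n} n≤m = trans (sym (ℤP.⊖-≥ n≤m)) (sym (ℤP.m-n≡m⊖n m n))

m≤m*n⁺ : ∀ m {n} → 0 < n → m ≤ m * n
m≤m*n⁺ m 0<n = subst (_≤ m * _) (ℕP.*-identityʳ m) (ℕP.*-monoʳ-≤ m 0<n)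

m≤n*m⁺ : ∀ m {n} → 0 < n → m ≤ n * m
m≤n*m⁺ m {n} 0<n = subst (_≤ n * m) (ℕP.*-identityˡ m) (ℕP.*-monoˡ-≤ m 0<n)

m*n>0 : ∀ {m n} → 0 < m → 0 < n → 0 < m * n
m*n>0 {m} {n} = ℕP.*-mono-≤ {1} {m} {1} {n}

m≤n⇒m∸1<n : ∀ {m n} → 0 < n → m ≤ n → m ∸ 1 < n
m≤n⇒m∸1<n {zero}  0<n _   = 0<n
m≤n⇒m∸1<n {suc m} _   m<n = m<n

n∸1<n : ∀ {n} → 0 < n → n ∸ 1 < n
n∸1<n {suc n} _ = ℕP.n<1+n n

module Expansion (a m s : ℕ) (1<a : 1 < a) (0<m : 0 < m) (0<s : 0 < s) where

  r : ℕ
  r = 2 * a * m * s ∸ 1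

  private
    twice : ∀ n → n + n ≡ 2 * n
    twice = ℕ-Solver.solve-∀

    0<2ms : 0 < 2 * m * s
    0<2ms = m*n>0 (m*n>0 {2} (s≤s z≤n) 0<m) 0<s

    2ms<2ams : 2 * m * s < 2 * a * m * s
    2ms<2ams = begin-strict
      2 * m * s               <⟨ ℕP.m<m+n (2 * m * s) 0<2ms ⟩
      2 * m * s + 2 * m * s   ≡⟨ twice (2 * m * s) ⟩
      2 * (2 * m * s)         ≤⟨ ℕP.*-monoˡ-≤ (2 * m * s) 1<a ⟩
      a * (2 * m * s)         ≡⟨ regroup a m s ⟩
      2 * a * m * s           ∎
      where
      open ℕP.≤-Reasoning
      regroup : ∀ a m s → a * (2 * m * s) ≡ 2 * a * m * s
      regroup = ℕ-Solver.solve-∀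

  2ms≤r : 2 * m * s ≤ r
  2ms≤r = ℕP.m+n≤o⇒m≤o∸n (2 * m * s) (subst (_≤ 2 * a * m * s) (ℕP.+-comm 1 (2 * m * s)) 2ms<2ams)

  s<r : s < r
  s<r = begin-strict
    s          <⟨ ℕP.m<m+n s 0<s ⟩
    s + s      ≡⟨ twice s ⟩
    2 * s      ≤⟨ ℕP.*-monoˡ-≤ s (ℕP.*-monoʳ-≤ 2 0<m) ⟩
    2 * m * s  ≤⟨ 2ms≤r ⟩
    r          ∎
    where open ℕP.≤-Reasoning

  2am-cast : + (2 * a * m) ≡ + 2 ℤ.* + a ℤ.* + m
  2am-cast = trans (ℤP.pos-* (2 * a) m) (cong (ℤ._* + m) (ℤP.pos-* 2 a))

  r-cast : + r ≡ + 2 ℤ.* + a ℤ.* + m ℤ.* + s ℤ.- + 1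
  r-cast = trans (pos-∸ (ℕP.≤-trans 0<2ms (ℕP.<⇒≤ 2ms<2ams)))
    (cong (ℤ._- + 1) (trans (ℤP.pos-* (2 * a * m) s) (cong (ℤ._* + s) 2am-cast)))

  c x D : ℕ → ℕ
  c K = a * K ∸ s
  x K = m * c K
  D K = m * (2 * K + m * (c K * c K))

  D-split : ∀ K → D K ≡ x K * x K + 2 * m * K
  D-split K = lemma m (c K) K
    where
    lemma : ∀ m c K → m * (2 * K + m * (c * c)) ≡ m * c * (m * c) + 2 * m * K
    lemma = ℕ-Solver.solve-∀

  module _ {K} (s≤K : s ≤ K) where

    K+s≤aK : K + s ≤ a * K
    K+s≤aK = begin
      K + s   ≤⟨ ℕP.+-monoʳ-≤ K s≤K ⟩
      K + K   ≡⟨ twice K ⟩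
      2 * K   ≤⟨ ℕP.*-monoˡ-≤ K 1<a ⟩
      a * K   ∎
      where open ℕP.≤-Reasoning

    isqrt-D : isqrt (D K) ≡ x K
    isqrt-D = isqrt-unique
      (subst (x K * x K ≤_) (sym (D-split K)) (ℕP.m≤m+n (x K * x K) (2 * m * K)))
      (subst₂ _<_ (sym (D-split K)) (sym (square-suc (x K))) (s≤s (ℕP.+-monoʳ-≤ (x K * x K) 2mK≤2x)))
      where
      2mK≤2x : 2 * m * K ≤ 2 * x K
      2mK≤2x = subst (2 * m * K ≤_) (ℕP.*-assoc 2 m (c K))
                     (ℕP.*-monoʳ-≤ (2 * m) (ℕP.m+n≤o⇒m≤o∸n K K+s≤aK))
      square-suc : ∀ y → suc y * suc y ≡ suc (y * y + 2 * y)
      square-suc = ℕ-Solver.solve-∀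

  module Triple (R T K : ℕ) (0<R : 0 < R) (0<T : 0 < T) (hK : R * (r * T) ≡ K) where

    private
      module TR = TripleRecurrence (+ a) (+ m) (+ s) (+ R) (+ T)

      r≤rT : r ≤ r * T
      r≤rT = m≤m*n⁺ r 0<T

      s≤K : s ≤ K
      s≤K = ℕP.≤-trans (ℕP.<⇒≤ s<r) (ℕP.≤-trans r≤rT (subst (r * T ≤_) hK (m≤n*m⁺ (r * T) 0<R)))

      2m-cast : + (2 * m) ≡ + 2 ℤ.* + m
      2m-cast = ℤP.pos-* 2 m

      rT-cast : + (r * T) ≡ TR.r ℤ.* + T
      rT-cast = trans (ℤP.pos-* r T) (cong (ℤ._* + T) r-cast)

      x-cast : + x K ≡ TR.X
      x-cast = trans (ℤP.pos-* m (c K)) (cong (+ m ℤ.*_)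
        (trans (pos-∸ (ℕP.≤-trans (ℕP.m≤n+m s K) (K+s≤aK s≤K))) (cong (ℤ._- + s)
          (trans (ℤP.pos-* a K) (cong (+ a ℤ.*_)
            (trans (cong +_ (sym hK)) (trans (ℤP.pos-* R (r * T)) (cong (+ R ℤ.*_) rT-cast))))))))

      Q₀-cast : + (2 * m * (r * T)) ≡ TR.Q₀
      Q₀-cast = trans (ℤP.pos-* (2 * m) (r * T)) (cong₂ ℤ._*_ 2m-cast rT-cast)

      Q₂-cast : + (r * R) ≡ TR.Q₂
      Q₂-cast = trans (ℤP.pos-* r R) (cong (ℤ._* + R) r-cast)

      Q₃-cast : + (2 * m * T) ≡ TR.Q₃
      Q₃-cast = trans (ℤP.pos-* (2 * m) T) (cong (ℤ._* + T) 2m-cast)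

      D-cast : + D K ≡ TR.Δ
      D-cast = trans (cong +_ (trans (D-split K) (trans (cong (λ n → x K * x K + 2 * m * n) (sym hK))
                                                   (regroup (x K) m R (r * T)))))
        (trans (ℤP.pos-+ (x K * x K) (R * (2 * m * (r * T))))
          (cong₂ ℤ._+_ (trans (ℤP.pos-* (x K) (x K)) (cong₂ ℤ._*_ x-cast x-cast))
                       (trans (ℤP.pos-* R _) (cong (+ R ℤ.*_) Q₀-cast))))
        where
        regroup : ∀ x m R y → x * x + 2 * m * (R * y) ≡ x * x + R * (2 * m * y)
        regroup = ℕ-Solver.solve-∀

      q₁-cast : + (a * R ∸ 1) ≡ TR.q₁
      q₁-cast = trans (pos-∸ (m*n>0 (ℕP.<⇒≤ 1<a) 0<R)) (cong (ℤ._- + 1) (ℤP.pos-* a R))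

      q₃-cast : + (2 * a * m * T ∸ 1) ≡ TR.q₃
      q₃-cast = trans (pos-∸ (m*n>0 (m*n>0 (m*n>0 {2} (s≤s z≤n) (ℕP.<⇒≤ 1<a)) 0<m) 0<T))
        (cong (ℤ._- + 1) (trans (ℤP.pos-* (2 * a * m) T) (cong (ℤ._* + T) 2am-cast)))

      hX : + isqrt (D K) ≡ TR.X
      hX = trans (cong +_ (isqrt-D s≤K)) x-cast

      open TR.Bounds (+<+ 0<m) (+<+ 0<s) (+<+ 0<R)
        (subst (+ 2 ℤ.≤_) (ℤP.pos-* a R) (+≤+ (ℕP.≤-trans 1<a (m≤m*n⁺ a 0<R))))
        (subst₂ ℤ._≤_ (ℤP.pos-* 2 s) rT-cast
          (+≤+ (ℕP.≤-trans (ℕP.*-monoˡ-≤ s (ℕP.*-monoʳ-≤ 2 0<m)) (ℕP.≤-trans 2ms≤r r≤rT))))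
        (subst₂ ℤ._≤_ (trans (ℤP.pos-* (2 * m) s) (cong (ℤ._* + s) 2m-cast)) Q₂-cast
          (+≤+ (ℕP.≤-trans 2ms≤r (m≤m*n⁺ r 0<R))))

    forward : Run (D K) (a * R ∸ 1 ∷ 1 ∷ 2 * a * m * T ∸ 1 ∷ [])
                (+ x K , + (2 * m * (r * T))) (+ x K , + (2 * m * T))
    forward = subst₂ (Run (D K) _) (sym (cong₂ _,_ x-cast Q₀-cast)) (sym (cong₂ _,_ x-cast Q₃-cast))
      (Run-recurrence hX D-cast TR.step₁ reduced₁ q₁-cast
      (Run-recurrence hX D-cast TR.step₂ reduced₂ refl
      (Run-recurrence hX D-cast TR.step₃ reduced₃ q₃-cast done)))

    backward : Run (D K) (2 * a * m * T ∸ 1 ∷ 1 ∷ a * R ∸ 1 ∷ []) (+ x K , + (r * R)) (+ x K , + R)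
    backward = subst₂ (Run (D K) _) (sym (cong₂ _,_ x-cast Q₂-cast)) (sym (cong (_, + R) x-cast))
      (Run-recurrence hX D-cast TR.step₃ʳ reduced₃ʳ q₃-cast
      (Run-recurrence hX D-cast TR.step₂ʳ reduced₂ʳ refl
      (Run-recurrence hX D-cast TR.step₁ʳ reduced₁ʳ q₁-cast done)))

  module Period (k : ℕ) (0<k : 0 < k) where

    K : ℕ
    K = r ^ k

    triple : ℕ → List ℕ
    triple j = a * r ^ j ∸ 1 ∷ 1 ∷ 2 * a * m * r ^ (k ∸ 1 ∸ j) ∸ 1 ∷ []

    triples : ℕ → List ℕ
    triples n = concatMap triple (upTo n)

    private
      0<r^ : ∀ n → 0 < r ^ n
      0<r^ zero    = s≤s z≤n
      0<r^ (suc n) = m*n>0 (ℕP.≤-trans 0<s (ℕP.<⇒≤ s<r)) (0<r^ n)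

      s≤K : s ≤ K
      s≤K = ℕP.≤-trans (ℕP.<⇒≤ s<r) (r≤r^ 0<k)
        where
        r≤r^ : ∀ {n} → 0 < n → r ≤ r ^ n
        r≤r^ {suc n} _ = m≤m*n⁺ r (0<r^ n)

      isq : isqrt (D K) ≡ x K
      isq = isqrt-D s≤K

    triples-∷ʳ : ∀ n → triples n ++ triple n ≡ triples (suc n)
    triples-∷ʳ n = begin
      triples n ++ triple n                    ≡⟨ cong (triples n ++_) (sym (LP.++-identityʳ (triple n))) ⟩
      triples n ++ concatMap triple (n ∷ [])   ≡⟨ sym (LP.concatMap-++ triple (upTo n) (n ∷ [])) ⟩
      concatMap triple (upTo n ++ n ∷ [])      ≡⟨ cong (concatMap triple) (LP.upTo-∷ʳ n) ⟩
      triples (suc n)                          ∎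
      where open ≡-Reasoning

    length-triples : ∀ n → length (triples n) ≡ 3 * n
    length-triples zero    = refl
    length-triples (suc n) = begin
      length (triples (suc n))         ≡⟨ cong length (sym (triples-∷ʳ n)) ⟩
      length (triples n ++ triple n)   ≡⟨ LP.length-++ (triples n) ⟩
      length (triples n) + 3           ≡⟨ cong (_+ 3) (length-triples n) ⟩
      3 * n + 3                        ≡⟨ lemma n ⟩
      3 * suc n                        ∎
      where
      open ≡-Reasoning
      lemma : ∀ n → 3 * n + 3 ≡ 3 * suc n
      lemma = ℕ-Solver.solve-∀

    triple-≡ : ∀ n t → suc n + t ≡ k → triple n ≡ (a * r ^ n ∸ 1 ∷ 1 ∷ 2 * a * m * r ^ t ∸ 1 ∷ [])
    triple-≡ n t refl = cong (λ e → a * r ^ n ∸ 1 ∷ 1 ∷ 2 * a * m * r ^ e ∸ 1 ∷ []) (ℕP.m+n∸m≡n n t)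

    split : ∀ n t → suc n + t ≡ k → r ^ n * (r * r ^ t) ≡ K
    split n t eq = trans (sym (ℕP.^-distribˡ-+-* r n (suc t))) (cong (r ^_) (trans (ℕP.+-suc n t) eq))

    forward-run : ∀ n t → n + t ≡ k → Run (D K) (triples n) (+ x K , + (2 * m * K)) (+ x K , + (2 * m * r ^ t))
    forward-run zero    t refl = done
    forward-run (suc n) t eq   = Run-≡ (triples-∷ʳ n)
      (Run-++ (forward-run n (suc t) (trans (ℕP.+-suc n t) eq))
              (Run-≡ (sym (triple-≡ n t eq)) (Triple.forward (r ^ n) (r ^ t) K (0<r^ n) (0<r^ t) (split n t eq))))

    backward-run : ∀ n t → n + t ≡ k → Run (D K) (reverse (triples n)) (+ x K , + r ^ n) (+ x K , + 1)
    backward-run zero    t _  = done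
    backward-run (suc n) t eq =
      Run-≡ (trans (sym (LP.reverse-++ (triples n) (triple n))) (cong reverse (triples-∷ʳ n)))
      (Run-++ (Run-≡ (sym (cong reverse (triple-≡ n t eq)))
                     (Triple.backward (r ^ n) (r ^ t) K (0<r^ n) (0<r^ t) (split n t eq)))
              (backward-run n (suc t) (trans (ℕP.+-suc n t) eq)))

    private
      c*2m : ∀ m c → c * (2 * m) ≡ m * c + m * c
      c*2m = ℕ-Solver.solve-∀

    initial : cfFloor (D K) (+ 0 , + 1) ≡ + x K × cfStep (D K) (+ 0 , + 1) ≡ (+ x K , + (2 * m * K))
    initial = cfStep-to-root isq (s≤s z≤n) (trans (ℕP.*-identityʳ (x K)) (sym (ℕP.+-identityʳ (x K))))
      (trans (D-split K) (cong (λ n → x K * x K + n) (sym (ℕP.*-identityˡ _))))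

    middle : Run (D K) (c K ∷ []) (+ x K , + (2 * m * 1)) (+ x K , + K)
    middle = Run-one (cfStep-to-root isq (m*n>0 {2 * m} (m*n>0 {2} (s≤s z≤n) 0<m) (s≤s z≤n))
      (trans (cong (c K *_) (ℕP.*-identityʳ (2 * m))) (c*2m m (c K)))
      (trans (D-split K) (cong (λ n → x K * x K + n * K) (sym (ℕP.*-identityʳ (2 * m))))))

    wrap : Run (D K) (2 * m * c K ∷ []) (+ x K , + 1) (+ x K , + (2 * m * K))
    wrap = Run-one (cfStep-to-root isq (s≤s z≤n)
      (trans (ℕP.*-identityʳ _) (trans (ℕP.*-comm (2 * m) (c K)) (c*2m m (c K))))
      (trans (D-split K) (cong (λ n → x K * x K + n) (sym (ℕP.*-identityˡ _)))))

    block-run : Run (D K) (block a m s r k) (+ x K , + (2 * m * K)) (+ x K , + (2 * m * K))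
    block-run = Run-++ (forward-run k 0 (ℕP.+-identityʳ k))
               (Run-++ middle (Run-++ (backward-run k 0 (ℕP.+-identityʳ k)) wrap))

    p : ℕ
    p = 2 + 6 * k

    length-block : length (block a m s r k) ≡ p
    length-block = begin
      length (triples k ++ c K ∷ reverse (triples k) ++ 2 * m * c K ∷ [])
        ≡⟨ LP.length-++ (triples k) ⟩
      length (triples k) + suc (length (reverse (triples k) ++ 2 * m * c K ∷ []))
        ≡⟨ cong (λ n → length (triples k) + suc n) (LP.length-++ (reverse (triples k))) ⟩
      length (triples k) + suc (length (reverse (triples k)) + 1)
        ≡⟨ cong (λ n → length (triples k) + suc (n + 1)) (LP.length-reverse (triples k)) ⟩
      length (triples k) + suc (length (triples k) + 1)
        ≡⟨ cong (λ n → n + suc (n + 1)) (length-triples k) ⟩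
      3 * k + suc (3 * k + 1)   ≡⟨ lemma k ⟩
      p                         ∎
      where
      open ≡-Reasoning
      lemma : ∀ k → 3 * k + suc (3 * k + 1) ≡ 2 + 6 * k
      lemma = ℕ-Solver.solve-∀

    run-from-1 : Run (D K) (block a m s r k) (cfState (D K) 1) (cfState (D K) 1)
    run-from-1 = subst₂ (Run (D K) _) (sym (proj₂ initial)) (sym (proj₂ initial)) block-run

    periodic : IsPeriod (D K) p
    periodic = periodic-from-return
      (subst (λ n → cfState (D K) (suc n) ≡ cfState (D K) 1) length-block (Run-state {n = 1} run-from-1))

    reading : ∀ i → i < p → cfSqrt (D K) (suc i) ≡ + nth (block a m s r k) i
    reading i i<p = Run-nth {n = 1} run-from-1 i (subst (i <_) (sym length-block) i<p)

    private
      ar^j≤c : ∀ {j} → j < k → a * r ^ j ≤ c K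
      ar^j≤c {j} j<k = ℕP.m+n≤o⇒m≤o∸n (a * r ^ j) (begin
        a * r ^ j + s               ≤⟨ ℕP.+-monoʳ-≤ (a * r ^ j) (m≤n*m⁺ s 0<ar^j) ⟩
        a * r ^ j + a * r ^ j * s   ≡⟨ sym (ℕP.*-suc (a * r ^ j) s) ⟩
        a * r ^ j * suc s           ≤⟨ ℕP.*-monoʳ-≤ (a * r ^ j) s<r ⟩
        a * r ^ j * r               ≤⟨ ℕP.*-monoʳ-≤ (a * r ^ j) (m≤m*n⁺ r (0<r^ t)) ⟩
        a * r ^ j * (r * r ^ t)     ≡⟨ ℕP.*-assoc a (r ^ j) (r * r ^ t) ⟩
        a * (r ^ j * (r * r ^ t))   ≡⟨ cong (a *_) (split j t (ℕP.m+[n∸m]≡n j<k)) ⟩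
        a * K                       ∎)
        where
        open ℕP.≤-Reasoning
        t = k ∸ suc j
        0<ar^j : 0 < a * r ^ j
        0<ar^j = m*n>0 (ℕP.<⇒≤ 1<a) (0<r^ j)

      0<c : 0 < c K
      0<c = ℕP.≤-trans (ℕP.<⇒≤ 1<a) (ℕP.≤-trans (m≤m*n⁺ a (s≤s z≤n)) (ar^j≤c 0<k))

      c<2mc : c K < 2 * m * c K
      c<2mc = ℕP.<-≤-trans (ℕP.m<m+n (c K) 0<c)
        (subst (_≤ 2 * m * c K) (lemma (c K)) (ℕP.*-monoˡ-≤ (c K) (ℕP.*-monoʳ-≤ 2 0<m)))
        where
        lemma : ∀ n → 2 * 1 * n ≡ n + n
        lemma = ℕ-Solver.solve-∀

      0<2mc : 0 < 2 * m * c K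
      0<2mc = ℕP.≤-trans (s≤s z≤n) c<2mc

      triple-bound : ∀ {j} → j < k → All (_< 2 * m * c K) (triple j)
      triple-bound {j} j<k =
        m≤n⇒m∸1<n 0<2mc (ℕP.≤-trans (ar^j≤c j<k) (ℕP.<⇒≤ c<2mc)) ∷
        ℕP.≤-<-trans 0<c c<2mc ∷
        m≤n⇒m∸1<n 0<2mc (subst (_≤ 2 * m * c K) (regroup a m (r ^ (k ∸ 1 ∸ j)))
                                (ℕP.*-monoʳ-≤ (2 * m) (ar^j≤c k∸1∸j<k))) ∷
        []
        where
        k∸1∸j<k : k ∸ 1 ∸ j < k
        k∸1∸j<k = ℕP.≤-<-trans (ℕP.m∸n≤m (k ∸ 1) j) (n∸1<n 0<k)
        regroup : ∀ a m y → 2 * m * (a * y) ≡ 2 * a * m * y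
        regroup = ℕ-Solver.solve-∀

    front : List ℕ
    front = triples k ++ c K ∷ reverse (triples k)

    private
      front-bound : All (_< 2 * m * c K) front
      front-bound = All.++⁺ triples-bound (c<2mc ∷ All-reverse triples-bound)
        where
        triples-bound : All (_< 2 * m * c K) (triples k)
        triples-bound = All.concat⁺ (All.map⁺ (All.applyUpTo⁺₁ id k triple-bound))

      block-split : block a m s r k ≡ front ++ 2 * m * c K ∷ []
      block-split = sym (LP.++-assoc (triples k) (c K ∷ reverse (triples k)) (2 * m * c K ∷ []))

      length-front : length front ≡ 1 + 6 * k
      length-front = ℕP.suc-injective (begin
        suc (length front)                   ≡⟨ ℕP.+-comm 1 (length front) ⟩
        length front + 1                     ≡⟨ sym (LP.length-++ front) ⟩
        length (front ++ 2 * m * c K ∷ [])   ≡⟨ cong length (sym block-split) ⟩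
        length (block a m s r k)             ≡⟨ length-block ⟩
        p                                    ∎)
        where open ≡-Reasoning

      top : cfSqrt (D K) p ≡ + (2 * m * c K)
      top = trans (reading (1 + 6 * k) (ℕP.n<1+n (1 + 6 * k))) (cong +_ (begin
        nth (block a m s r k) (1 + 6 * k)               ≡⟨ cong (λ L → nth L (1 + 6 * k)) block-split ⟩
        nth (front ++ 2 * m * c K ∷ []) (1 + 6 * k)
          ≡⟨ cong (nth (front ++ 2 * m * c K ∷ [])) (sym length-front) ⟩
        nth (front ++ 2 * m * c K ∷ []) (length front)  ≡⟨ nth-++-length front ⟩
        2 * m * c K                                     ∎))
        where open ≡-Reasoning

      below-top : ∀ i → 0 < i → i < p → cfSqrt (D K) i ℤ.< cfSqrt (D K) p
      below-top (suc j) _ (s≤s j<) = subst₂ ℤ._<_ (sym (reading j (ℕP.m<n⇒m<1+n j<))) (sym top)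
        (+<+ (subst (λ L → nth L j < 2 * m * c K) (sym block-split)
          (nth-++-All (2 * m * c K ∷ []) front-bound (subst (j <_) (sym length-front) j<))))

    result : PeriodLength (D K) (6 * k + 2)
           × cfSqrt (D K) 0 ≡ + (m * c K)
           × (∀ n → cfSqrt (D K) (1 + n) ≡ + nth (block a m s r k) (n % (2 + 6 * k)))
    result = subst (PeriodLength (D K)) (ℕP.+-comm 2 (6 * k)) (s≤s z≤n , periodic , no-shorter-period below-top)
           , proj₁ initial
           , λ n → trans (IsPeriod-mod p periodic n) (reading (n % p) (ℕD.m%n<n n p))

theorem3 : (a m s k : ℕ) → 1 < a → 0 < m → 0 < s → 0 < k →
    let r = 2 * a * m * s ∸ 1
        c = a * r ^ k ∸ s
        D = m * (2 * r ^ k + m * (c * c))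
    in PeriodLength D (6 * k + 2)
       × cfSqrt D 0 ≡ + (m * c)
       × (∀ n → cfSqrt D (1 + n) ≡ + nth (block a m s r k) (n % (2 + 6 * k)))
theorem3 a m s k 1<a 0<m 0<s 0<k = Expansion.Period.result a m s 1<a 0<m 0<s k 0<k
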